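{- (1) Bimonoids with complementation are term equivalent to involutive residuated pomonoids. (2) Bisemigroups with complementation are term equivalent to involutive residuated posemigroups which satisfy the inequalities $x \leq x\cdot(y\backslash y)$, $x \leq (y\backslash y)\cdot x$, $x\leq x\cdot(y/y)$, $x\leq (y/y)\cdot x$. In both cases the term equivalence keeps the order, the multiplication and the two unary operations $x^{\ell}, x^{r}$; in one direction one forgets $+$ (and $0$), in the other one defines $x+y := (y^{\ell}\cdot x^{\ell})^{r}$ (and, for pomonoids, $0 := 1^{r}$).
   Context: A posemigroup is a semigroup $\langle A,\cdot\rangle$ with a partial order $\leq$ such that $x\leq y$ implies $xz\leq yz$ and $zx\leq zy$; a pomonoid is a posemigroup with a multiplicative unit $1$. A bisemigroup $\langle A,\leq,\cdot,+\rangle$ consists of a partially ordered set with two associative operations such that $\langle A,\leq,\cdot\rangle$ and $\langle A,\geq,+\rangle$ are posemigroups (so both operations are order preserving in each argument with respect to $\leq$) and the hemidistributive laws $x\cdot(y+z)\leq (x\cdot y)+z$ and $(z+y)\cdot x\leq z+(y\cdot x)$ hold. A bimonoid $\langle A,\leq,\cdot,1,+,0\rangle$ is a bisemigroup with a unit $1$ for $\cdot$ and a unit $0$ for $+$. In a bisemigroup, $y$ is a left complement of $x$ if for all $w$: $w+(y\cdot x)\leq w$, $(y\cdot x)+w\leq w$, $w\leq w\cdot(x+y)$, $w\leq (x+y)\cdot w$; and $y$ is a right complement of $x$ if for all $w$: $w+(x\cdot y)\leq w$, $(x\cdot y)+w\leq w$, $w\leq w\cdot(y+x)$, $w\leq (y+x)\cdot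 w$. A bisemigroup (bimonoid) with complementation is a bisemigroup (bimonoid) expanded by unary operations $x^{\ell}$, $x^{r}$ such that for every $x$, $x^{\ell}$ is a left complement and $x^{r}$ a right complement of $x$. An involutive residuated posemigroup $\langle A,\leq,\cdot,{}^{\ell},{}^{r}\rangle$ is a posemigroup with two order-reversing unary operations satisfying $(x^{\ell})^{r}=x=(x^{r})^{\ell}$ such that the operations $x\backslash y := (y^{\ell}\cdot x)^{r}$ and $y/x := (x\cdot y^{r})^{\ell}$ satisfy $x\cdot y\leq z \iff y\leq x\backslash z \iff x\leq z/y$. An involutive residuated pomonoid is an involutive residuated posemigroup with a multiplicative unit $1$. -}

module Defs where

open import Level using (Level; _⊔_)
open import Data.Product using (_×_)
open import Function using (flip)
open import Relation.Binary.Core using (Rel)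
open import Relation.Binary.Structures using (IsPartialOrder)
open import Relation.Binary.PropositionalEquality using (_≡_)

private
  variable
    a ℓ : Level

Op₂ : Set a → Set a
Op₂ A = A → A → A

Op₁ : Set a → Set a
Op₁ A = A → A

module _ {A : Set a} where

  record IsPosemigroup (_≤_ : Rel A ℓ) (_·_ : Op₂ A) : Set (a ⊔ ℓ) where
    field
      isPartialOrder : IsPartialOrder _≡_ _≤_
      assoc          : ∀ x y z → ((x · y) · z) ≡ (x · (y · z))
      monoˡ          : ∀ {x y} z → x ≤ y → (x · z) ≤ (y · z)
      monoʳ          : ∀ {x y} z → x ≤ y → (z · x) ≤ (z · y)

  record IsPomonoid (_≤_ : Rel A ℓ) (_·_ : Op₂ A) (e : A) : Set (a ⊔ ℓ) where
    field
      isPosemigroup : IsPosemigroup _≤_ _·_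
      identityˡ     : ∀ x → (e · x) ≡ x
      identityʳ     : ∀ x → (x · e) ≡ x

  record IsBisemigroup (_≤_ : Rel A ℓ) (_·_ _+_ : Op₂ A) : Set (a ⊔ ℓ) where
    field
      ·-posemigroup : IsPosemigroup _≤_ _·_
      +-posemigroup : IsPosemigroup (flip _≤_) _+_
      hemidistribˡ  : ∀ x y z → (x · (y + z)) ≤ ((x · y) + z)
      hemidistribʳ  : ∀ x y z → ((z + y) · x) ≤ (z + (y · x))

  record IsBimonoid (_≤_ : Rel A ℓ) (_·_ : Op₂ A) (one : A) (_+_ : Op₂ A) (zero : A)
         : Set (a ⊔ ℓ) where
    field
      isBisemigroup : IsBisemigroup _≤_ _·_ _+_
      ·-identityˡ   : ∀ x → (one · x) ≡ x
      ·-identityʳ   : ∀ x → (x · one) ≡ x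
      +-identityˡ   : ∀ x → (zero + x) ≡ x
      +-identityʳ   : ∀ x → (x + zero) ≡ x

  record IsLeftComplement (_≤_ : Rel A ℓ) (_·_ _+_ : Op₂ A) (x y : A) : Set (a ⊔ ℓ) where
    field
      c₁ : ∀ w → (w + (y · x)) ≤ w
      c₂ : ∀ w → ((y · x) + w) ≤ w
      c₃ : ∀ w → w ≤ (w · (x + y))
      c₄ : ∀ w → w ≤ ((x + y) · w)

  record IsRightComplement (_≤_ : Rel A ℓ) (_·_ _+_ : Op₂ A) (x y : A) : Set (a ⊔ ℓ) where
    field
      c₁ : ∀ w → (w + (x · y)) ≤ w
      c₂ : ∀ w → ((x · y) + w) ≤ w
      c₃ : ∀ w → w ≤ (w · (y + x))
      c₄ : ∀ w → w ≤ ((y + x) · w)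

  record IsBisemigroupWithComplementation (_≤_ : Rel A ℓ) (_·_ _+_ : Op₂ A)
         (ˡ ʳ : Op₁ A) : Set (a ⊔ ℓ) where
    field
      isBisemigroup : IsBisemigroup _≤_ _·_ _+_
      leftCompl     : ∀ x → IsLeftComplement _≤_ _·_ _+_ x (ˡ x)
      rightCompl    : ∀ x → IsRightComplement _≤_ _·_ _+_ x (ʳ x)

  record IsBimonoidWithComplementation (_≤_ : Rel A ℓ) (_·_ : Op₂ A) (one : A)
         (_+_ : Op₂ A) (zero : A) (ˡ ʳ : Op₁ A) : Set (a ⊔ ℓ) where
    field
      isBimonoid : IsBimonoid _≤_ _·_ one _+_ zero
      leftCompl  : ∀ x → IsLeftComplement _≤_ _·_ _+_ x (ˡ x)
      rightCompl : ∀ x → IsRightComplement _≤_ _·_ _+_ x (ʳ x)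

  -- residuals defined from the involutions
  -- x \ y := (y^ℓ · x)^r      y / x := (x · y^r)^ℓ
  under : Op₂ A → Op₁ A → Op₁ A → Op₂ A
  under _·_ ˡ ʳ x y = ʳ (ˡ y · x)

  over : Op₂ A → Op₁ A → Op₁ A → Op₂ A
  over _·_ ˡ ʳ y x = ˡ (x · ʳ y)

  plusDef : Op₂ A → Op₁ A → Op₁ A → Op₂ A
  plusDef _·_ ˡ ʳ x y = ʳ (ˡ y · ˡ x)

  record IsInvolutiveResiduatedPosemigroup (_≤_ : Rel A ℓ) (_·_ : Op₂ A)
         (ˡ ʳ : Op₁ A) : Set (a ⊔ ℓ) where
    _\\_ = under _·_ ˡ ʳ
    _//_ = over _·_ ˡ ʳ
    field
      isPosemigroup : IsPosemigroup _≤_ _·_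
      ˡ-antitone    : ∀ {x y} → x ≤ y → ˡ y ≤ ˡ x
      ʳ-antitone    : ∀ {x y} → x ≤ y → ʳ y ≤ ʳ x
      ʳˡ-inverse    : ∀ x → ʳ (ˡ x) ≡ x
      ˡʳ-inverse    : ∀ x → ˡ (ʳ x) ≡ x
      resid₁        : ∀ x y z → (x · y) ≤ z → y ≤ (x \\ z)
      resid₂        : ∀ x y z → y ≤ (x \\ z) → (x · y) ≤ z
      resid₃        : ∀ x y z → (x · y) ≤ z → x ≤ (z // y)
      resid₄        : ∀ x y z → x ≤ (z // y) → (x · y) ≤ z

  record IsInvolutiveResiduatedPomonoid (_≤_ : Rel A ℓ) (_·_ : Op₂ A) (one : A)
         (ˡ ʳ : Op₁ A) : Set (a ⊔ ℓ) where
    field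
      isIRPosemigroup : IsInvolutiveResiduatedPosemigroup _≤_ _·_ ˡ ʳ
      identityˡ       : ∀ x → (one · x) ≡ x
      identityʳ       : ∀ x → (x · one) ≡ x

  record ExtraInequalities (_≤_ : Rel A ℓ) (_·_ : Op₂ A) (ˡ ʳ : Op₁ A) : Set (a ⊔ ℓ) where
    _\\_ = under _·_ ˡ ʳ
    _//_ = over _·_ ˡ ʳ
    field
      ineq₁ : ∀ x y → x ≤ (x · (y \\ y))
      ineq₂ : ∀ x y → x ≤ ((y \\ y) · x)
      ineq₃ : ∀ x y → x ≤ (x · (y // y))
      ineq₄ : ∀ x y → x ≤ ((y // y) · x)

{-# OPTIONS --safe #-}
-- In a bisemigroup with complementation, x ↦ ʳ x + _ is right adjoint to
-- x · _ and _ + ˡ x is right adjoint to _ · x, by hemidistributivity and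
-- the complement axioms.  With uniqueness of complements this makes ˡ
-- and ʳ mutually inverse antitone maps, identifies x \ z with ʳ x + z and z / x
-- with z + ˡ x, and forces x + y = ʳ (ˡ y · ˡ x).  Conversely, in an
-- involutive residuated posemigroup x + y := ʳ (ˡ y · ˡ x) is the residual
-- ˡ x \ y, from which hemidistributivity follows, and the extra
-- inequalities are exactly the complement axioms.
module Submission where

open import Defs
open import Level using (Level)
open import Data.Product using (_×_; _,_)
open import Function using (flip)
open import Relation.Binary.Bundles using (Poset)
open import Relation.Binary.Core using (Rel)
open import Relation.Binary.Structures using (IsPartialOrder)
open import Relation.Binary.PropositionalEquality using (_≡_; refl; sym; cong; module ≡-Reasoning)
import Relation.Binary.Construct.Flip.EqAndOrd as Flip
import Relation.Binary.Reasoning.PartialOrder as PartialOrderReasoning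

poset : ∀ {a ℓ} {A : Set a} {_≤_ : Rel A ℓ} → IsPartialOrder _≡_ _≤_ → Poset a a ℓ
poset isPartialOrder = record { isPartialOrder = isPartialOrder }

module ≤-Reasoning {a ℓ} {A : Set a} {_≤_ : Rel A ℓ} (isPartialOrder : IsPartialOrder _≡_ _≤_) =
  PartialOrderReasoning (poset isPartialOrder)

flip-isPosemigroup : ∀ {a ℓ} {A : Set a} {_≤_ : Rel A ℓ} {_·_ : Op₂ A} →
                     IsPosemigroup _≤_ _·_ → IsPosemigroup _≤_ (flip _·_)
flip-isPosemigroup P = record
  { isPartialOrder = isPartialOrder
  ; assoc          = λ x y z → sym (assoc z y x)
  ; monoˡ          = monoʳ
  ; monoʳ          = monoˡ
  }
  where open IsPosemigroup P

-- Reversing both operations and swapping ˡ and ʳ preserves the axioms, so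
-- each law below has a mirror image obtained through this map.
opposite : ∀ {a ℓ} {A : Set a} {_≤_ : Rel A ℓ} {_·_ _+_ : Op₂ A} {ˡ ʳ : Op₁ A} →
           IsBisemigroupWithComplementation _≤_ _·_ _+_ ˡ ʳ →
           IsBisemigroupWithComplementation _≤_ (flip _·_) (flip _+_) ʳ ˡ
opposite B = record
  { isBisemigroup = record
    { ·-posemigroup = flip-isPosemigroup ·-posemigroup
    ; +-posemigroup = flip-isPosemigroup +-posemigroup
    ; hemidistribˡ  = hemidistribʳ
    ; hemidistribʳ  = hemidistribˡ
    }
  ; leftCompl  = λ x → record { c₁ = R.c₂ x ; c₂ = R.c₁ x ; c₃ = R.c₄ x ; c₄ = R.c₃ x }
  ; rightCompl = λ x → record { c₁ = L.c₂ x ; c₂ = L.c₁ x ; c₃ = L.c₄ x ; c₄ = L.c₃ x }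
  }
  where
  open IsBisemigroupWithComplementation B
  open IsBisemigroup isBisemigroup
  module L x = IsLeftComplement (leftCompl x)
  module R x = IsRightComplement (rightCompl x)

module ComplementLaws {a ℓ} {A : Set a} {_≤_ : Rel A ℓ} {_·_ _+_ : Op₂ A} {ˡ ʳ : Op₁ A}
                      (B : IsBisemigroupWithComplementation _≤_ _·_ _+_ ˡ ʳ) where
  open IsBisemigroupWithComplementation B
  open IsBisemigroup isBisemigroup
  open IsPosemigroup ·-posemigroup using (isPartialOrder) renaming (monoʳ to ·-monoʳ)
  open IsPosemigroup +-posemigroup using () renaming (monoˡ to +-monoˡ; monoʳ to +-monoʳ)
  open IsPartialOrder isPartialOrder using (antisym)
  open ≤-Reasoning isPartialOrder
  module L x = IsLeftComplement (leftCompl x)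
  module R x = IsRightComplement (rightCompl x)

  complement-≤ : ∀ {x y z} → (∀ w → w ≤ (w · (y + z))) → (∀ w → ((x · y) + w) ≤ w) → x ≤ z
  complement-≤ {x} {y} {z} unit absorb = begin
    x             ≤⟨ unit x ⟩
    x · (y + z)   ≤⟨ hemidistribˡ x y z ⟩
    (x · y) + z   ≤⟨ absorb z ⟩
    z             ∎

  ˡʳ-inverse : ∀ x → ˡ (ʳ x) ≡ x
  ˡʳ-inverse x = antisym (complement-≤ (R.c₃ x) (L.c₂ (ʳ x))) (complement-≤ (L.c₃ (ʳ x)) (R.c₂ x))

  ˡ-antitone : ∀ {x y} → x ≤ y → ˡ y ≤ ˡ x
  ˡ-antitone {x} {y} x≤y = complement-≤ (L.c₃ x) λ w → begin
    (ˡ y · x) + w   ≤⟨ +-monoˡ w (·-monoʳ (ˡ y) x≤y) ⟩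
    (ˡ y · y) + w   ≤⟨ L.c₂ y w ⟩
    w               ∎

  ≤ʳ⇒≤ˡ : ∀ {x y} → x ≤ ʳ y → y ≤ ˡ x
  ≤ʳ⇒≤ˡ {x} {y} x≤ʳy = begin
    y         ≡⟨ ˡʳ-inverse y ⟨
    ˡ (ʳ y)   ≤⟨ ˡ-antitone x≤ʳy ⟩
    ˡ x       ∎

  ·≤⇒≤ʳ+ : ∀ {x y z} → (x · y) ≤ z → y ≤ (ʳ x + z)
  ·≤⇒≤ʳ+ {x} {y} {z} x·y≤z = begin
    y                 ≤⟨ R.c₄ x y ⟩
    (ʳ x + x) · y     ≤⟨ hemidistribʳ y x (ʳ x) ⟩
    ʳ x + (x · y)     ≤⟨ +-monoʳ (ʳ x) x·y≤z ⟩
    ʳ x + z           ∎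

  ≤ʳ+⇒·≤ : ∀ {x y z} → y ≤ (ʳ x + z) → (x · y) ≤ z
  ≤ʳ+⇒·≤ {x} {y} {z} y≤ʳx+z = begin
    x · y             ≤⟨ ·-monoʳ x y≤ʳx+z ⟩
    x · (ʳ x + z)     ≤⟨ hemidistribˡ x (ʳ x) z ⟩
    (x · ʳ x) + z     ≤⟨ R.c₂ x z ⟩
    z                 ∎

module ResidualLaws {a ℓ} {A : Set a} {_≤_ : Rel A ℓ} {_·_ _+_ : Op₂ A} {ˡ ʳ : Op₁ A}
                    (B : IsBisemigroupWithComplementation _≤_ _·_ _+_ ˡ ʳ) where
  open ComplementLaws B public
  open ComplementLaws (opposite B) public using () renaming
    ( ˡʳ-inverse to ʳˡ-inverse
    ; ˡ-antitone to ʳ-antitone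
    ; ≤ʳ⇒≤ˡ      to ≤ˡ⇒≤ʳ
    ; ·≤⇒≤ʳ+     to ·≤⇒≤+ˡ
    ; ≤ʳ+⇒·≤     to ≤+ˡ⇒·≤
    )
  open IsBisemigroupWithComplementation B using (isBisemigroup)
  open IsBisemigroup isBisemigroup using (·-posemigroup)
  open IsPosemigroup ·-posemigroup using (isPartialOrder)
  open IsPartialOrder isPartialOrder using (antisym; reflexive)
  open ≤-Reasoning isPartialOrder

  ·≤⇒≤under : ∀ {x y z} → (x · y) ≤ z → y ≤ under _·_ ˡ ʳ x z
  ·≤⇒≤under {x} {y} {z} x·y≤z = ≤ˡ⇒≤ʳ (≤ʳ+⇒·≤ (begin
    x                 ≤⟨ ·≤⇒≤+ˡ x·y≤z ⟩
    z + ˡ y           ≡⟨ cong (_+ ˡ y) (ʳˡ-inverse z) ⟨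
    ʳ (ˡ z) + ˡ y     ∎))

  ≤under⇒·≤ : ∀ {x y z} → y ≤ under _·_ ˡ ʳ x z → (x · y) ≤ z
  ≤under⇒·≤ {x} {y} {z} y≤x\z = ≤+ˡ⇒·≤ (begin
    x                 ≤⟨ ·≤⇒≤ʳ+ (≤ʳ⇒≤ˡ y≤x\z) ⟩
    ʳ (ˡ z) + ˡ y     ≡⟨ cong (_+ ˡ y) (ʳˡ-inverse z) ⟩
    z + ˡ y           ∎)

  -- Both sides are the largest t with ˡ x · t ≤ y, because
  -- plusDef x y is by definition the residual ˡ x \ y.
  +≡plusDef : ∀ x y → (x + y) ≡ plusDef _·_ ˡ ʳ x y
  +≡plusDef x y = antisym
    (·≤⇒≤under (≤ʳ+⇒·≤ (reflexive (cong (_+ y) (sym (ʳˡ-inverse x))))))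
    (begin
      plusDef _·_ ˡ ʳ x y   ≤⟨ ·≤⇒≤ʳ+ (≤under⇒·≤ (reflexive refl)) ⟩
      ʳ (ˡ x) + y           ≡⟨ cong (_+ y) (ʳˡ-inverse x) ⟩
      x + y                 ∎)

  ʳ+≡under : ∀ x z → (ʳ x + z) ≡ under _·_ ˡ ʳ x z
  ʳ+≡under x z = begin-equality
    ʳ x + z                         ≡⟨ +≡plusDef (ʳ x) z ⟩
    under _·_ ˡ ʳ (ˡ (ʳ x)) z       ≡⟨ cong (λ u → under _·_ ˡ ʳ u z) (ˡʳ-inverse x) ⟩
    under _·_ ˡ ʳ x z               ∎

  ≤·under : ∀ x y → x ≤ (x · under _·_ ˡ ʳ y y)
  ≤·under x y = begin
    x                           ≤⟨ R.c₃ y x ⟩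
    x · (ʳ y + y)               ≡⟨ cong (x ·_) (ʳ+≡under y y) ⟩
    x · under _·_ ˡ ʳ y y       ∎

  ≤under· : ∀ x y → x ≤ (under _·_ ˡ ʳ y y · x)
  ≤under· x y = begin
    x                           ≤⟨ R.c₄ y x ⟩
    (ʳ y + y) · x               ≡⟨ cong (_· x) (ʳ+≡under y y) ⟩
    under _·_ ˡ ʳ y y · x       ∎

module ComplementedBisemigroup {a ℓ} {A : Set a} {_≤_ : Rel A ℓ} {_·_ _+_ : Op₂ A} {ˡ ʳ : Op₁ A}
                               (B : IsBisemigroupWithComplementation _≤_ _·_ _+_ ˡ ʳ) where
  open ResidualLaws B
  open ResidualLaws (opposite B) using () renaming
    ( ·≤⇒≤under to ·≤⇒≤over
    ; ≤under⇒·≤ to ≤over⇒·≤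
    ; ≤·under   to ≤over·
    ; ≤under·   to ≤·over
    )
  open ResidualLaws B public using (+≡plusDef)
  open IsBisemigroupWithComplementation B using (isBisemigroup)
  open IsBisemigroup isBisemigroup using (·-posemigroup)

  isInvolutiveResiduatedPosemigroup : IsInvolutiveResiduatedPosemigroup _≤_ _·_ ˡ ʳ
  isInvolutiveResiduatedPosemigroup = record
    { isPosemigroup = ·-posemigroup
    ; ˡ-antitone    = ˡ-antitone
    ; ʳ-antitone    = ʳ-antitone
    ; ʳˡ-inverse    = ʳˡ-inverse
    ; ˡʳ-inverse    = ˡʳ-inverse
    ; resid₁        = λ _ _ _ → ·≤⇒≤under
    ; resid₂        = λ _ _ _ → ≤under⇒·≤
    ; resid₃        = λ _ _ _ → ·≤⇒≤over
    ; resid₄        = λ _ _ _ → ≤over⇒·≤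
    }

  extraInequalities : ExtraInequalities _≤_ _·_ ˡ ʳ
  extraInequalities = record { ineq₁ = ≤·under ; ineq₂ = ≤under· ; ineq₃ = ≤·over ; ineq₄ = ≤over· }

module ComplementedBimonoid {a ℓ} {A : Set a} {_≤_ : Rel A ℓ} {_·_ _+_ : Op₂ A} {one zero : A} {ˡ ʳ : Op₁ A}
                            (M : IsBimonoidWithComplementation _≤_ _·_ one _+_ zero ˡ ʳ) where
  open IsBimonoidWithComplementation M
  open IsBimonoid isBimonoid

  isBisemigroupWithComplementation : IsBisemigroupWithComplementation _≤_ _·_ _+_ ˡ ʳ
  isBisemigroupWithComplementation = record
    { isBisemigroup = isBisemigroup ; leftCompl = leftCompl ; rightCompl = rightCompl }

  open ComplementedBisemigroup isBisemigroupWithComplementation public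
    using (+≡plusDef)
  open ComplementedBisemigroup isBisemigroupWithComplementation
    using (isInvolutiveResiduatedPosemigroup)
  open ResidualLaws isBisemigroupWithComplementation using (ˡʳ-inverse; ʳˡ-inverse)

  isInvolutiveResiduatedPomonoid : IsInvolutiveResiduatedPomonoid _≤_ _·_ one ˡ ʳ
  isInvolutiveResiduatedPomonoid = record
    { isIRPosemigroup = isInvolutiveResiduatedPosemigroup
    ; identityˡ       = ·-identityˡ
    ; identityʳ       = ·-identityʳ
    }

  zero≡ʳone : zero ≡ ʳ one
  zero≡ʳone = begin
    zero                           ≡⟨ ʳˡ-inverse zero ⟨
    ʳ (ˡ zero)                     ≡⟨ cong ʳ (·-identityʳ (ˡ zero)) ⟨
    ʳ (ˡ zero · one)               ≡⟨ cong (λ u → ʳ (ˡ zero · u)) (ˡʳ-inverse one) ⟨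
    plusDef _·_ ˡ ʳ (ʳ one) zero   ≡⟨ +≡plusDef (ʳ one) zero ⟨
    ʳ one + zero                   ≡⟨ +-identityʳ (ʳ one) ⟩
    ʳ one                          ∎
    where open ≡-Reasoning

module InvolutiveResiduatedPosemigroup {a ℓ} {A : Set a} {_≤_ : Rel A ℓ} {_·_ : Op₂ A} {ˡ ʳ : Op₁ A}
                                       (I : IsInvolutiveResiduatedPosemigroup _≤_ _·_ ˡ ʳ) where
  open IsInvolutiveResiduatedPosemigroup I
  open IsPosemigroup isPosemigroup
  open IsPartialOrder isPartialOrder using (reflexive)
  open ≤-Reasoning isPartialOrder

  private
    _+_ : Op₂ A
    _+_ = plusDef _·_ ˡ ʳ

  ˡ·+≤ : ∀ x y → (ˡ x · (x + y)) ≤ y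
  ˡ·+≤ x y = resid₂ (ˡ x) (x + y) y (reflexive refl)

  ˡ·≤ˡ : ∀ x y → (ˡ (x · y) · x) ≤ ˡ y
  ˡ·≤ˡ x y = resid₄ (ˡ (x · y)) x (ˡ y) (reflexive (cong (λ u → ˡ (x · u)) (sym (ʳˡ-inverse y))))

  ˡ≤⇒ʳ≤ : ∀ {x y} → ˡ x ≤ y → ʳ y ≤ x
  ˡ≤⇒ʳ≤ {x} {y} ˡx≤y = begin
    ʳ y       ≤⟨ ʳ-antitone ˡx≤y ⟩
    ʳ (ˡ x)   ≡⟨ ʳˡ-inverse x ⟩
    x         ∎

  +-assoc : ∀ x y z → ((x + y) + z) ≡ (x + (y + z))
  +-assoc x y z = begin-equality
    ʳ (ˡ z · ˡ (ʳ (ˡ y · ˡ x)))   ≡⟨ cong (λ u → ʳ (ˡ z · u)) (ˡʳ-inverse (ˡ y · ˡ x)) ⟩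
    ʳ (ˡ z · (ˡ y · ˡ x))         ≡⟨ cong ʳ (assoc (ˡ z) (ˡ y) (ˡ x)) ⟨
    ʳ ((ˡ z · ˡ y) · ˡ x)         ≡⟨ cong (λ u → ʳ (u · ˡ x)) (ˡʳ-inverse (ˡ z · ˡ y)) ⟨
    ʳ (ˡ (ʳ (ˡ z · ˡ y)) · ˡ x)   ∎

  +-isPosemigroup : IsPosemigroup (flip _≤_) _+_
  +-isPosemigroup = record
    { isPartialOrder = Flip.isPartialOrder isPartialOrder
    ; assoc = +-assoc
    ; monoˡ = λ z y≤x → ʳ-antitone (monoʳ (ˡ z) (ˡ-antitone y≤x))
    ; monoʳ = λ z y≤x → ʳ-antitone (monoˡ (ˡ z) (ˡ-antitone y≤x))
    }

  hemidistribˡ : ∀ x y z → (x · (y + z)) ≤ ((x · y) + z)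
  hemidistribˡ x y z = resid₁ (ˡ (x · y)) (x · (y + z)) z (begin
    ˡ (x · y) · (x · (y + z))     ≡⟨ assoc (ˡ (x · y)) x (y + z) ⟨
    (ˡ (x · y) · x) · (y + z)     ≤⟨ monoˡ (y + z) (ˡ·≤ˡ x y) ⟩
    ˡ y · (y + z)                 ≤⟨ ˡ·+≤ y z ⟩
    z                             ∎)

  hemidistribʳ : ∀ x y z → ((z + y) · x) ≤ (z + (y · x))
  hemidistribʳ x y z = resid₁ (ˡ z) ((z + y) · x) (y · x) (begin
    ˡ z · ((z + y) · x)           ≡⟨ assoc (ˡ z) (z + y) x ⟨
    (ˡ z · (z + y)) · x           ≤⟨ monoˡ x (ˡ·+≤ z y) ⟩
    y · x                         ∎)

  isBisemigroup : IsBisemigroup _≤_ _·_ _+_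
  isBisemigroup = record
    { ·-posemigroup = isPosemigroup
    ; +-posemigroup = +-isPosemigroup
    ; hemidistribˡ  = hemidistribˡ
    ; hemidistribʳ  = hemidistribʳ
    }

  module _ (E : ExtraInequalities _≤_ _·_ ˡ ʳ) where
    open ExtraInequalities E

    over-ˡ : ∀ x → over _·_ ˡ ʳ (ˡ x) (ˡ x) ≡ ˡ (ˡ x · x)
    over-ˡ x = cong (λ u → ˡ (ˡ x · u)) (ʳˡ-inverse x)

    ʳ+≡under : ∀ x → (ʳ x + x) ≡ under _·_ ˡ ʳ x x
    ʳ+≡under x = cong (λ u → ʳ (ˡ x · u)) (ˡʳ-inverse x)

    leftComplement : ∀ x → IsLeftComplement _≤_ _·_ _+_ x (ˡ x)
    leftComplement x = record
      { c₁ = λ w → ˡ≤⇒ʳ≤ (begin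
          ˡ w                                 ≤⟨ ineq₄ (ˡ w) (ˡ x) ⟩
          over _·_ ˡ ʳ (ˡ x) (ˡ x) · ˡ w      ≡⟨ cong (_· ˡ w) (over-ˡ x) ⟩
          ˡ (ˡ x · x) · ˡ w                   ∎)
      ; c₂ = λ w → ˡ≤⇒ʳ≤ (begin
          ˡ w                                 ≤⟨ ineq₃ (ˡ w) (ˡ x) ⟩
          ˡ w · over _·_ ˡ ʳ (ˡ x) (ˡ x)      ≡⟨ cong (ˡ w ·_) (over-ˡ x) ⟩
          ˡ w · ˡ (ˡ x · x)                   ∎)
      ; c₃ = λ w → ineq₁ w (ˡ x)
      ; c₄ = λ w → ineq₂ w (ˡ x)
      }

    rightComplement : ∀ x → IsRightComplement _≤_ _·_ _+_ x (ʳ x)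
    rightComplement x = record
      { c₁ = λ w → ˡ≤⇒ʳ≤ (ineq₄ (ˡ w) x)
      ; c₂ = λ w → ˡ≤⇒ʳ≤ (ineq₃ (ˡ w) x)
      ; c₃ = λ w → begin
          w                           ≤⟨ ineq₁ w x ⟩
          w · under _·_ ˡ ʳ x x       ≡⟨ cong (w ·_) (ʳ+≡under x) ⟨
          w · (ʳ x + x)               ∎
      ; c₄ = λ w → begin
          w                           ≤⟨ ineq₂ w x ⟩
          under _·_ ˡ ʳ x x · w       ≡⟨ cong (_· w) (ʳ+≡under x) ⟨
          (ʳ x + x) · w               ∎
      }

    isBisemigroupWithComplementation : IsBisemigroupWithComplementation _≤_ _·_ _+_ ˡ ʳ
    isBisemigroupWithComplementation = record
      { isBisemigroup = isBisemigroup
      ; leftCompl     = leftComplement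
      ; rightCompl    = rightComplement
      }

module InvolutiveResiduatedPomonoid {a ℓ} {A : Set a} {_≤_ : Rel A ℓ} {_·_ : Op₂ A} {one : A} {ˡ ʳ : Op₁ A}
                                    (I : IsInvolutiveResiduatedPomonoid _≤_ _·_ one ˡ ʳ) where
  open IsInvolutiveResiduatedPomonoid I
  open IsInvolutiveResiduatedPosemigroup isIRPosemigroup
  open IsPosemigroup isPosemigroup
  open IsPartialOrder isPartialOrder using (reflexive)
  open ≤-Reasoning isPartialOrder

  one≤under : ∀ y → one ≤ under _·_ ˡ ʳ y y
  one≤under y = resid₁ y one y (reflexive (identityʳ y))

  one≤over : ∀ y → one ≤ over _·_ ˡ ʳ y y
  one≤over y = resid₃ one y y (reflexive (identityˡ y))

  ≤·-of-one≤ : ∀ {u} → one ≤ u → ∀ x → x ≤ (x · u)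
  ≤·-of-one≤ {u} one≤u x = begin
    x         ≡⟨ identityʳ x ⟨
    x · one   ≤⟨ monoʳ x one≤u ⟩
    x · u     ∎

  ≤-·of-one≤ : ∀ {u} → one ≤ u → ∀ x → x ≤ (u · x)
  ≤-·of-one≤ {u} one≤u x = begin
    x         ≡⟨ identityˡ x ⟨
    one · x   ≤⟨ monoˡ x one≤u ⟩
    u · x     ∎

  extraInequalities : ExtraInequalities _≤_ _·_ ˡ ʳ
  extraInequalities = record
    { ineq₁ = λ x y → ≤·-of-one≤ (one≤under y) x
    ; ineq₂ = λ x y → ≤-·of-one≤ (one≤under y) x
    ; ineq₃ = λ x y → ≤·-of-one≤ (one≤over y) x
    ; ineq₄ = λ x y → ≤-·of-one≤ (one≤over y) x
    }

  ʳone+-identityˡ : ∀ x → plusDef _·_ ˡ ʳ (ʳ one) x ≡ x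
  ʳone+-identityˡ x = begin-equality
    ʳ (ˡ x · ˡ (ʳ one))   ≡⟨ cong (λ u → ʳ (ˡ x · u)) (ˡʳ-inverse one) ⟩
    ʳ (ˡ x · one)         ≡⟨ cong ʳ (identityʳ (ˡ x)) ⟩
    ʳ (ˡ x)               ≡⟨ ʳˡ-inverse x ⟩
    x                     ∎

  ʳone+-identityʳ : ∀ x → plusDef _·_ ˡ ʳ x (ʳ one) ≡ x
  ʳone+-identityʳ x = begin-equality
    ʳ (ˡ (ʳ one) · ˡ x)   ≡⟨ cong (λ u → ʳ (u · ˡ x)) (ˡʳ-inverse one) ⟩
    ʳ (one · ˡ x)         ≡⟨ cong ʳ (identityˡ (ˡ x)) ⟩
    ʳ (ˡ x)               ≡⟨ ʳˡ-inverse x ⟩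
    x                     ∎

  isBimonoidWithComplementation :
    IsBimonoidWithComplementation _≤_ _·_ one (plusDef _·_ ˡ ʳ) (ʳ one) ˡ ʳ
  isBimonoidWithComplementation = record
    { isBimonoid = record
      { isBisemigroup = isBisemigroup
      ; ·-identityˡ   = identityˡ
      ; ·-identityʳ   = identityʳ
      ; +-identityˡ   = ʳone+-identityˡ
      ; +-identityʳ   = ʳone+-identityʳ
      }
    ; leftCompl  = leftComplement extraInequalities
    ; rightCompl = rightComplement extraInequalities
    }
    where open InvolutiveResiduatedPosemigroup isIRPosemigroup

mainTheorem1 : ∀ {a ℓ : Level} {A : Set a} (_≤_ : Rel A ℓ) (_·_ : A → A → A) (ˡ ʳ : A → A) →
    -- (1) bimonoids with complementation vs involutive residuated pomonoids
    ( ( ∀ (one : A) (_+_ : A → A → A) (zero : A) →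
          IsBimonoidWithComplementation _≤_ _·_ one _+_ zero ˡ ʳ →
          IsInvolutiveResiduatedPomonoid _≤_ _·_ one ˡ ʳ
          × (∀ x y → (x + y) ≡ plusDef _·_ ˡ ʳ x y)
          × zero ≡ ʳ one )
      × ( ∀ (one : A) →
          IsInvolutiveResiduatedPomonoid _≤_ _·_ one ˡ ʳ →
          IsBimonoidWithComplementation _≤_ _·_ one (plusDef _·_ ˡ ʳ) (ʳ one) ˡ ʳ ) )
    -- (2) bisemigroups with complementation vs involutive residuated
    --     posemigroups satisfying the four extra inequalities
    × ( ( ∀ (_+_ : A → A → A) →
          IsBisemigroupWithComplementation _≤_ _·_ _+_ ˡ ʳ →
          IsInvolutiveResiduatedPosemigroup _≤_ _·_ ˡ ʳ
          × ExtraInequalities _≤_ _·_ ˡ ʳ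
          × (∀ x y → (x + y) ≡ plusDef _·_ ˡ ʳ x y) )
      × ( IsInvolutiveResiduatedPosemigroup _≤_ _·_ ˡ ʳ →
          ExtraInequalities _≤_ _·_ ˡ ʳ →
          IsBisemigroupWithComplementation _≤_ _·_ (plusDef _·_ ˡ ʳ) ˡ ʳ ) )
mainTheorem1 _≤_ _·_ ˡ ʳ =
  ( ( λ _ _ _ M → let open ComplementedBimonoid M in
        isInvolutiveResiduatedPomonoid , +≡plusDef , zero≡ʳone )
  , λ _ I → InvolutiveResiduatedPomonoid.isBimonoidWithComplementation I )
  , ( ( λ _ B → let open ComplementedBisemigroup B in
          isInvolutiveResiduatedPosemigroup , extraInequalities , +≡plusDef )
    , InvolutiveResiduatedPosemigroup.isBisemigroupWithComplementation )
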